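{- Let $p$ be an odd prime and $r$ an integer with $1 < r \leq p-1$. Define $$P = \sum_{j=1}^{p-1-r}\sum_{l=j}^{j+r} (-1)^{r-l+1}\, l \binom{r}{l-j}\binom{p}{j}.$$ Then $P \equiv 0 \pmod{p^2}$.
   Context: Empty sums are $0$. -}

module Defs where

open import Data.Nat as ℕ using (ℕ; zero; suc; _∸_)
open import Data.Nat.Combinatorics using (_C_)
open import Data.Integer as ℤ using (ℤ; +_; -_)

-- Σ[ i = a .. b ] f i : sum over integers a ≤ i ≤ b (empty sum = 0 if b < a)
-- implemented as sum over i = a + k for k < (b + 1) ∸ a
sumFrom : ℕ → ℕ → (ℕ → ℤ) → ℤ
sumFrom a zero    f = + 0
sumFrom a (suc n) f = f a ℤ.+ sumFrom (suc a) n f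

sumRange : ℕ → ℕ → (ℕ → ℤ) → ℤ
sumRange a b f = sumFrom a (suc b ∸ a) f

-- (-1)^e for the integer exponent e = r - l + 1; since (-1)^(-k) = (-1)^k,
-- it depends only on the parity of e, i.e. on the parity of r + l + 1.
signPow : ℕ → ℤ
signPow zero          = + 1
signPow (suc zero)    = - (+ 1)
signPow (suc (suc n)) = signPow n

P : ℕ → ℕ → ℤ
P p r = sumRange 1 (p ∸ 1 ∸ r) λ j →
          sumRange j (j ℕ.+ r) λ l →
            signPow (r ℕ.+ l ℕ.+ 1) ℤ.* (+ l) ℤ.* (+ (r C (l ∸ j))) ℤ.* (+ (p C j))

-- The sum P vanishes identically, not just modulo p².  After substituting
-- l = j + k, the inner sum is Σₖ C(r,k) g(k) for the alternating-linear
-- sequence g(k) = ±(-1)ᵏ (j + k) C(p,j).  By Pascal's rule such a binomial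
-- sum equals the same sum of the forward differences g(k) + g(k+1) with r
-- lowered by one; applying this twice leaves the second difference of g,
-- which is zero.
module Submission where

open import Defs
open import Data.Nat using (ℕ; _<_; _≤_; _∸_; _^_)
open import Data.Nat.Primality using (Prime)
open import Data.Nat.DivMod using (_%_)
open import Relation.Binary.PropositionalEquality using (_≡_)
open import Data.Integer using (+_)
open import Data.Integer.Divisibility using (_∣_)

open import Data.Nat as ℕ using (zero; suc; s≤s)
import Data.Nat.Properties as ℕ
open import Data.Nat.Combinatorics using (_C_; nCk+nC[k+1]≡[n+1]C[k+1]; k>n⇒nCk≡0)
open import Data.Nat.Divisibility using (_∣0)
open import Data.Integer as ℤ using (ℤ; -_)
import Data.Integer.Properties as ℤ
open import Relation.Binary.PropositionalEquality
  using (refl; sym; trans; cong; cong₂; subst; module ≡-Reasoning)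
open import Data.Integer.Solver using (module +-*-Solver)
open +-*-Solver using (solve; _:+_; _:*_; :-_; _:=_; con)
open import Data.Nat.Tactic.RingSolver using (solve-∀)

sumFrom-cong : ∀ a n {f g : ℕ → ℤ} → (∀ k → f k ≡ g k) → sumFrom a n f ≡ sumFrom a n g
sumFrom-cong a zero    f≡g = refl
sumFrom-cong a (suc n) f≡g = cong₂ ℤ._+_ (f≡g a) (sumFrom-cong (suc a) n f≡g)

sumFrom-zero : ∀ a n {f : ℕ → ℤ} → (∀ k → f k ≡ + 0) → sumFrom a n f ≡ + 0
sumFrom-zero a zero    f≡0 = refl
sumFrom-zero a (suc n) f≡0 = cong₂ ℤ._+_ (f≡0 a) (sumFrom-zero (suc a) n f≡0)

sumFrom-suc : ∀ a n (f : ℕ → ℤ) → sumFrom (suc a) n f ≡ sumFrom a n (λ k → f (suc k))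
sumFrom-suc a zero    f = refl
sumFrom-suc a (suc n) f = cong (λ t → f (suc a) ℤ.+ t) (sumFrom-suc (suc a) n f)

sumFrom-from0 : ∀ a n (f : ℕ → ℤ) → sumFrom a n f ≡ sumFrom 0 n (λ k → f (a ℕ.+ k))
sumFrom-from0 zero    n f = refl
sumFrom-from0 (suc a) n f = trans (sumFrom-suc a n f) (sumFrom-from0 a n (λ k → f (suc k)))

sumFrom-+ : ∀ a n (f g : ℕ → ℤ) →
            sumFrom a n (λ k → f k ℤ.+ g k) ≡ sumFrom a n f ℤ.+ sumFrom a n g
sumFrom-+ a zero    f g = refl
sumFrom-+ a (suc n) f g = begin
    (f a ℤ.+ g a) ℤ.+ sumFrom (suc a) n (λ k → f k ℤ.+ g k)
  ≡⟨ cong (λ t → (f a ℤ.+ g a) ℤ.+ t) (sumFrom-+ (suc a) n f g) ⟩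
    (f a ℤ.+ g a) ℤ.+ (sumFrom (suc a) n f ℤ.+ sumFrom (suc a) n g)
  ≡⟨ solve 4 (λ x y u v → (x :+ y) :+ (u :+ v) := (x :+ u) :+ (y :+ v)) refl
             (f a) (g a) (sumFrom (suc a) n f) (sumFrom (suc a) n g) ⟩
    (f a ℤ.+ sumFrom (suc a) n f) ℤ.+ (g a ℤ.+ sumFrom (suc a) n g)
  ∎
  where open ≡-Reasoning

sumFrom-snoc : ∀ a n (f : ℕ → ℤ) → sumFrom a (suc n) f ≡ sumFrom a n f ℤ.+ f (a ℕ.+ n)
sumFrom-snoc a zero    f = begin
    f a ℤ.+ + 0     ≡⟨ ℤ.+-identityʳ (f a) ⟩
    f a             ≡⟨ cong f (sym (ℕ.+-identityʳ a)) ⟩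
    f (a ℕ.+ 0)     ≡⟨ sym (ℤ.+-identityˡ _) ⟩
    + 0 ℤ.+ f (a ℕ.+ 0)
  ∎
  where open ≡-Reasoning
sumFrom-snoc a (suc n) f = begin
    f a ℤ.+ sumFrom (suc a) (suc n) f
  ≡⟨ cong (λ t → f a ℤ.+ t) (sumFrom-snoc (suc a) n f) ⟩
    f a ℤ.+ (sumFrom (suc a) n f ℤ.+ f (suc a ℕ.+ n))
  ≡⟨ sym (ℤ.+-assoc (f a) _ _) ⟩
    (f a ℤ.+ sumFrom (suc a) n f) ℤ.+ f (suc a ℕ.+ n)
  ≡⟨ cong (λ i → (f a ℤ.+ sumFrom (suc a) n f) ℤ.+ f i) (sym (ℕ.+-suc a n)) ⟩
    (f a ℤ.+ sumFrom (suc a) n f) ℤ.+ f (a ℕ.+ suc n)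
  ∎
  where open ≡-Reasoning

binomialSum : ℕ → (ℕ → ℤ) → ℤ
binomialSum n g = sumFrom 0 (suc n) (λ k → g k ℤ.* + (n C k))

Δ : (ℕ → ℤ) → ℕ → ℤ
Δ g k = g k ℤ.+ g (suc k)

binomialSum-suc : ∀ n g → binomialSum (suc n) g ≡ binomialSum n (Δ g)
binomialSum-suc n g = begin
    g 0 ℤ.* + 1 ℤ.+ sumFrom 1 (suc n) (λ k → g k ℤ.* + (suc n C k))
  ≡⟨ cong (λ t → g 0 ℤ.* + 1 ℤ.+ t) (trans (sumFrom-suc 0 (suc n) (λ k → g k ℤ.* + (suc n C k))) (sumFrom-cong 0 (suc n) pascal)) ⟩
    g 0 ℤ.* + 1 ℤ.+ sumFrom 0 (suc n) (λ k → low k ℤ.+ high k)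
  ≡⟨ cong (λ t → g 0 ℤ.* + 1 ℤ.+ t) (sumFrom-+ 0 (suc n) low high) ⟩
    g 0 ℤ.* + 1 ℤ.+ (sumFrom 0 (suc n) low ℤ.+ sumFrom 0 (suc n) high)
  ≡⟨ cong (λ t → g 0 ℤ.* + 1 ℤ.+ (sumFrom 0 (suc n) low ℤ.+ t)) highSum ⟩
    g 0 ℤ.* + 1 ℤ.+ (sumFrom 0 (suc n) low ℤ.+ (sumFrom 0 n high ℤ.+ + 0))
  ≡⟨ solve 3 (λ c x y → c :+ (x :+ (y :+ con (+ 0))) := (c :+ y) :+ x) refl
             (g 0 ℤ.* + 1) (sumFrom 0 (suc n) low) (sumFrom 0 n high) ⟩
    (g 0 ℤ.* + 1 ℤ.+ sumFrom 0 n high) ℤ.+ sumFrom 0 (suc n) low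
  ≡⟨ cong (ℤ._+ sumFrom 0 (suc n) low) (cong (λ t → g 0 ℤ.* + 1 ℤ.+ t) (sym (sumFrom-suc 0 n same))) ⟩
    sumFrom 0 (suc n) same ℤ.+ sumFrom 0 (suc n) low
  ≡⟨ sym (sumFrom-+ 0 (suc n) same low) ⟩
    sumFrom 0 (suc n) (λ k → same k ℤ.+ low k)
  ≡⟨ sumFrom-cong 0 (suc n) (λ k → sym (ℤ.*-distribʳ-+ (+ (n C k)) (g k) (g (suc k)))) ⟩
    binomialSum n (Δ g)
  ∎
  where
  open ≡-Reasoning
  same low high : ℕ → ℤ
  same k = g k ℤ.* + (n C k)
  low  k = g (suc k) ℤ.* + (n C k)
  high k = g (suc k) ℤ.* + (n C suc k)
  pascal : ∀ k → g (suc k) ℤ.* + (suc n C suc k) ≡ low k ℤ.+ high k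
  pascal k = trans (cong (λ t → g (suc k) ℤ.* + t) (sym (nCk+nC[k+1]≡[n+1]C[k+1] n k)))
                   (ℤ.*-distribˡ-+ (g (suc k)) (+ (n C k)) (+ (n C suc k)))
  highSum : sumFrom 0 (suc n) high ≡ sumFrom 0 n high ℤ.+ + 0
  highSum = trans (sumFrom-snoc 0 n high)
    (cong (λ t → sumFrom 0 n high ℤ.+ t)
      (trans (cong (λ t → g (suc n) ℤ.* + t) (k>n⇒nCk≡0 (ℕ.n<1+n n))) (ℤ.*-zeroʳ (g (suc n)))))

binomialSum-Δ²≡0 : ∀ m g → (∀ k → Δ (Δ g) k ≡ + 0) → binomialSum (suc (suc m)) g ≡ + 0
binomialSum-Δ²≡0 m g Δ²g≡0 = begin
    binomialSum (suc (suc m)) g   ≡⟨ binomialSum-suc (suc m) g ⟩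
    binomialSum (suc m) (Δ g)     ≡⟨ binomialSum-suc m (Δ g) ⟩
    binomialSum m (Δ (Δ g))       ≡⟨ sumFrom-zero 0 (suc m) (λ k → cong (ℤ._* + (m C k)) (Δ²g≡0 k)) ⟩
    + 0
  ∎
  where open ≡-Reasoning

signPow-suc : ∀ n → signPow (suc n) ≡ - signPow n
signPow-suc zero          = refl
signPow-suc (suc zero)    = refl
signPow-suc (suc (suc n)) = signPow-suc n

Δ-alternatingLinear : ∀ e j c k →
  Δ (λ i → signPow (e ℕ.+ i) ℤ.* + (j ℕ.+ i) ℤ.* c) k ≡ - signPow (e ℕ.+ k) ℤ.* c
Δ-alternatingLinear e j c k = begin
    s ℤ.* + (j ℕ.+ k) ℤ.* c ℤ.+ signPow (e ℕ.+ suc k) ℤ.* + (j ℕ.+ suc k) ℤ.* c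
  ≡⟨ cong₂ (λ t u → s ℤ.* + (j ℕ.+ k) ℤ.* c ℤ.+ t ℤ.* + u ℤ.* c)
           (trans (cong signPow (ℕ.+-suc e k)) (signPow-suc (e ℕ.+ k))) (ℕ.+-suc j k) ⟩
    s ℤ.* + (j ℕ.+ k) ℤ.* c ℤ.+ (- s) ℤ.* (+ 1 ℤ.+ + (j ℕ.+ k)) ℤ.* c
  ≡⟨ solve 3 (λ s x c → s :* x :* c :+ (:- s) :* (con (+ 1) :+ x) :* c := (:- s) :* c) refl
             s (+ (j ℕ.+ k)) c ⟩
    - s ℤ.* c
  ∎
  where
  open ≡-Reasoning
  s : ℤ
  s = signPow (e ℕ.+ k)

Δ²-alternatingLinear : ∀ e j c k →
  Δ (Δ (λ i → signPow (e ℕ.+ i) ℤ.* + (j ℕ.+ i) ℤ.* c)) k ≡ + 0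
Δ²-alternatingLinear e j c k = begin
    Δ g k ℤ.+ Δ g (suc k)
  ≡⟨ cong₂ ℤ._+_ (Δ-alternatingLinear e j c k) (Δ-alternatingLinear e j c (suc k)) ⟩
    - s ℤ.* c ℤ.+ - signPow (e ℕ.+ suc k) ℤ.* c
  ≡⟨ cong (λ t → - s ℤ.* c ℤ.+ - t ℤ.* c)
          (trans (cong signPow (ℕ.+-suc e k)) (signPow-suc (e ℕ.+ k))) ⟩
    - s ℤ.* c ℤ.+ - (- s) ℤ.* c
  ≡⟨ solve 2 (λ s c → (:- s) :* c :+ (:- (:- s)) :* c := con (+ 0)) refl s c ⟩
    + 0
  ∎
  where
  open ≡-Reasoning
  g : ℕ → ℤ
  g i = signPow (e ℕ.+ i) ℤ.* + (j ℕ.+ i) ℤ.* c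
  s : ℤ
  s = signPow (e ℕ.+ k)

innerSum≡0 : ∀ m c j →
  sumRange j (j ℕ.+ suc (suc m)) (λ l →
    signPow (suc (suc m) ℕ.+ l ℕ.+ 1) ℤ.* (+ l) ℤ.* (+ (suc (suc m) C (l ∸ j))) ℤ.* c) ≡ + 0
innerSum≡0 m c j = begin
    sumFrom j (suc (j ℕ.+ r) ∸ j) F   ≡⟨ cong (λ n → sumFrom j n F) length ⟩
    sumFrom j (suc r) F               ≡⟨ sumFrom-from0 j (suc r) F ⟩
    sumFrom 0 (suc r) (λ k → F (j ℕ.+ k))
                                      ≡⟨ sumFrom-cong 0 (suc r) reindex ⟩
    binomialSum r g                   ≡⟨ binomialSum-Δ²≡0 m g (Δ²-alternatingLinear (r ℕ.+ j ℕ.+ 1) j c) ⟩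
    + 0
  ∎
  where
  open ≡-Reasoning
  r : ℕ
  r = suc (suc m)
  F g : ℕ → ℤ
  F l = signPow (r ℕ.+ l ℕ.+ 1) ℤ.* (+ l) ℤ.* (+ (r C (l ∸ j))) ℤ.* c
  g k = signPow (r ℕ.+ j ℕ.+ 1 ℕ.+ k) ℤ.* + (j ℕ.+ k) ℤ.* c
  length : suc (j ℕ.+ r) ∸ j ≡ suc r
  length = trans (cong (_∸ j) (sym (ℕ.+-suc j r))) (ℕ.m+n∸m≡n j (suc r))
  exponent : ∀ a b k → a ℕ.+ (b ℕ.+ k) ℕ.+ 1 ≡ a ℕ.+ b ℕ.+ 1 ℕ.+ k
  exponent = solve-∀
  reindex : ∀ k → F (j ℕ.+ k) ≡ g k ℤ.* + (r C k)
  reindex k = begin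
      signPow (r ℕ.+ (j ℕ.+ k) ℕ.+ 1) ℤ.* x ℤ.* + (r C (j ℕ.+ k ∸ j)) ℤ.* c
    ≡⟨ cong₂ (λ e i → signPow e ℤ.* x ℤ.* + (r C i) ℤ.* c) (exponent r j k) (ℕ.m+n∸m≡n j k) ⟩
      s ℤ.* x ℤ.* + (r C k) ℤ.* c
    ≡⟨ solve 4 (λ s x d c → s :* x :* d :* c := s :* x :* c :* d) refl s x (+ (r C k)) c ⟩
      g k ℤ.* + (r C k)
    ∎
    where
    x s : ℤ
    x = + (j ℕ.+ k)
    s = signPow (r ℕ.+ j ℕ.+ 1 ℕ.+ k)

P≡0 : ∀ p r → 1 < r → P p r ≡ + 0
P≡0 p (suc (suc m)) (s≤s (s≤s _)) =
  sumFrom-zero 1 (p ∸ 1 ∸ suc (suc m)) (λ j → innerSum≡0 m (+ (p C j)) j)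

lemma3p4 : (p r : ℕ) → Prime p → p % 2 ≡ 1 → 1 < r → r ≤ p ∸ 1 →
    (+ (p ^ 2)) ∣ P p r
lemma3p4 p r _ _ 1<r _ = subst (+ (p ^ 2) ∣_) (sym (P≡0 p r 1<r)) ((p ^ 2) ∣0)
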